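{- For every natural number $n$ and every positive natural number $m$, \[ \sum_{i=m}^{2m-1} \left\lfloor \frac{n+i}{2m} \right\rfloor \;-\; \sum_{i=0}^{m-1} \left\lfloor \frac{n+i}{2m} \right\rfloor \;=\; 2m \cdot \mathrm{Zigzag}\!\left(\frac{n}{2m}\right). \]
   Context: For a real number $x$, $\mathrm{Zigzag}(x) = \min\left(x - \lfloor x \rfloor,\ \lceil x \rceil - x\right)$, i.e. the distance from $x$ to the nearest integer. -}

module Defs where

open import Data.Nat using (ℕ; _+_)
open import Data.List using (List; map; upTo)
open import Data.Integer using (ℤ)
import Data.Integer as ℤ
open import Data.Rational using (ℚ; _/_; _-_; _⊓_; floor; ceiling)

ℤtoℚ : ℤ → ℚ
ℤtoℚ z = z / 1

Zigzag : ℚ → ℚ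
Zigzag x = (x - ℤtoℚ (floor x)) ⊓ (ℤtoℚ (ceiling x) - x)

sumFrom : ℕ → ℕ → (ℕ → ℤ) → ℤ
sumFrom a k f = Data.List.foldr ℤ._+_ (ℤ.+ 0) (map (λ j → f (a + j)) (upTo k))
  where import Data.List

-- Write n = q N + r with N = 2 m and 0 ≤ r < N. For 0 ≤ i < N, ⌊(n + i) / N⌋ is q plus 0 or 1, the 1
-- occurring exactly when r + i ≥ N. So the q's cancel, the upper half-sum counts min(r, m) such indices
-- and the lower one max(0, r − m), leaving min(r, N − r). On the other side n / N has fractional part
-- r / N, so N · Zigzag (n / N) = min(r, N − r) as well.

module Submission where

open import Data.Nat.Base as ℕ using (ℕ; zero; suc; NonZero; _+_; _*_; _∸_; _⊓_; _≤_; _<_)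
import Data.Nat.Properties as ℕ
open import Data.Nat.Properties using (m*n≢0)
import Data.Nat.DivMod as ℕ
import Data.Nat.GCD as ℕ
import Data.Nat.Tactic.RingSolver as ℕ-Solver
open import Data.Nat.Coprimality using (Coprime; coprime-/gcd)
open import Data.Nat.Divisibility using (divides-refl)
open import Data.Integer.Base as ℤ using (ℤ; +_; _-_)
import Data.Integer.Properties as ℤ
import Data.Integer.DivMod as ℤ
import Data.Integer.Tactic.RingSolver as ℤ-Solver
open import Data.Rational.Base as ℚ using (ℚ; _/_; mkℚ+; floor; ceiling; toℚᵘ) renaming (_*_ to _*ℚ_)
import Data.Rational.Properties as ℚ
open import Data.Rational.Unnormalised.Base as ℚᵘ using (mkℚᵘ; *≡*; *≤*; _≃_)
import Data.Rational.Unnormalised.Properties as ℚᵘ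
open import Data.List.Base using (map; upTo; applyUpTo; foldr)
open import Data.List.Properties using (map-applyUpTo; map-cong)
open import Data.Sum.Base using (inj₁; inj₂)
open import Function.Base using (id; _∘_)
open import Relation.Nullary.Decidable.Core using (Dec; yes; no)
open import Relation.Nullary.Negation using (¬_)
open import Relation.Binary.PropositionalEquality
open import Algebra.Properties.CommutativeSemigroup ℤ.+-commutativeSemigroup
  using () renaming (interchange to +-interchange)

open import Defs

sumFrom-cong : ∀ a k {f g : ℕ → ℤ} → (∀ i → f i ≡ g i) → sumFrom a k f ≡ sumFrom a k g
sumFrom-cong a k f≗g = cong (foldr ℤ._+_ (+ 0)) (map-cong (λ j → f≗g (a + j)) (upTo k))

sumFrom-shift : ∀ n a k (f : ℕ → ℤ) → sumFrom a k (λ i → f (n + i)) ≡ sumFrom (n + a) k f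
sumFrom-shift n a k f =
  cong (foldr ℤ._+_ (+ 0)) (map-cong (λ j → cong f (sym (ℕ.+-assoc n a j))) (upTo k))

sumFrom-suc : ∀ a k (f : ℕ → ℤ) → sumFrom a (suc k) f ≡ f a ℤ.+ sumFrom (suc a) k f
sumFrom-suc a k f = cong₂ ℤ._+_ (cong f (ℕ.+-identityʳ a)) (cong (foldr ℤ._+_ (+ 0)) (begin
  map h (applyUpTo suc k)             ≡⟨ map-applyUpTo suc h k ⟩
  applyUpTo (h ∘ suc) k               ≡⟨ map-applyUpTo id (h ∘ suc) k ⟨
  map (h ∘ suc) (upTo k)              ≡⟨ map-cong (λ j → cong f (ℕ.+-suc a j)) (upTo k) ⟩
  map (λ j → f (suc a + j)) (upTo k)  ∎))
  where
  open ≡-Reasoning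
  h : ℕ → ℤ
  h j = f (a + j)

infixl 7 _div_
_div_ : ℕ → (N : ℕ) .{{_ : NonZero N}} → ℤ
i div N = + (i ℕ./ N)

module _ (N : ℕ) .{{_ : NonZero N}} where

  sumFrom-div-periodic : ∀ a k q → sumFrom (a + q * N) k (_div N) ≡ sumFrom a k (_div N) ℤ.+ + (k * q)
  sumFrom-div-periodic a zero    q = refl
  sumFrom-div-periodic a (suc k) q = begin
    sumFrom (a + q * N) (suc k) (_div N)
      ≡⟨ sumFrom-suc (a + q * N) k (_div N) ⟩
    (a + q * N) div N ℤ.+ sumFrom (suc a + q * N) k (_div N)
      ≡⟨ cong₂ ℤ._+_ (cong +_ [a+qN]/N≡a/N+q) (sumFrom-div-periodic (suc a) k q) ⟩
    (a div N ℤ.+ + q) ℤ.+ (S ℤ.+ + (k * q))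
      ≡⟨ +-interchange (a div N) (+ q) S (+ (k * q)) ⟩
    (a div N ℤ.+ S) ℤ.+ (+ q ℤ.+ + (k * q))
      ≡⟨ cong (ℤ._+ + (suc k * q)) (sumFrom-suc a k (_div N)) ⟨
    sumFrom a (suc k) (_div N) ℤ.+ + (suc k * q)
      ∎
    where
    open ≡-Reasoning
    S : ℤ
    S = sumFrom (suc a) k (_div N)
    [a+qN]/N≡a/N+q : (a + q * N) ℕ./ N ≡ a ℕ./ N + q
    [a+qN]/N≡a/N+q = trans (ℕ.+-distrib-/-∣ʳ a (divides-refl q)) (cong (λ t → a ℕ./ N + t) (ℕ.m*n/n≡m q N))

  -- When a + k ≤ 2N each term is 0 or 1, and it is 1 exactly for the indices j with a + j ≥ N.
  sumFrom-div-window : ∀ a k → a + k ≤ N + N → sumFrom a k (_div N) ≡ + (k ∸ (N ∸ a))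
  sumFrom-div-window a zero    _         = cong +_ (sym (ℕ.0∸n≡0 (N ∸ a)))
  sumFrom-div-window a (suc k) a+1+k≤2N = begin
    sumFrom a (suc k) (_div N)              ≡⟨ sumFrom-suc a k (_div N) ⟩
    a div N ℤ.+ sumFrom (suc a) k (_div N)  ≡⟨ cong (λ s → a div N ℤ.+ s) (sumFrom-div-window (suc a) k 1+a+k≤2N) ⟩
    + (a ℕ./ N + (k ∸ (N ∸ suc a)))         ≡⟨ cong +_ (step (a ℕ.<? N)) ⟩
    + (suc k ∸ (N ∸ a))                     ∎
    where
    open ≡-Reasoning
    1+a+k≤2N : suc a + k ≤ N + N
    1+a+k≤2N = subst (_≤ N + N) (ℕ.+-suc a k) a+1+k≤2N
    a<2N : a < N + N
    a<2N = ℕ.<-≤-trans (ℕ.m<m+n a ℕ.z<s) a+1+k≤2N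
    step : Dec (a < N) → a ℕ./ N + (k ∸ (N ∸ suc a)) ≡ suc k ∸ (N ∸ a)
    step (yes a<N) = begin
      a ℕ./ N + (k ∸ (N ∸ suc a))  ≡⟨ cong (_+ (k ∸ (N ∸ suc a))) (ℕ.m<n⇒m/n≡0 a<N) ⟩
      suc k ∸ suc (N ∸ suc a)      ≡⟨ cong (suc k ∸_) (ℕ.+-∸-assoc 1 a<N) ⟨
      suc k ∸ (N ∸ a)              ∎
    step (no a≮N) = begin
      a ℕ./ N + (k ∸ (N ∸ suc a))  ≡⟨ cong₂ (λ x y → x + (k ∸ y)) a/N≡1 (ℕ.m≤n⇒m∸n≡0 (ℕ.m≤n⇒m≤1+n N≤a)) ⟩
      suc k ∸ 0                    ≡⟨ cong (suc k ∸_) (ℕ.m≤n⇒m∸n≡0 N≤a) ⟨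
      suc k ∸ (N ∸ a)              ∎
      where
      N≤a : N ≤ a
      N≤a = ℕ.≮⇒≥ a≮N
      a/N≡1 : a ℕ./ N ≡ 1
      a/N≡1 = trans (ℕ.m/n≡1+[m∸n]/n N≤a) (cong suc (ℕ.m<n⇒m/n≡0 (ℕ.m<n+o⇒m∸n<o a N a<2N)))

upper-minus-lower-count : ∀ {N} m r → m + m ≡ N →
                          + (m ∸ (N ∸ (m + r))) - + (m ∸ (N ∸ r)) ≡ + (r ⊓ (N ∸ r))
upper-minus-lower-count {N} m r m+m≡N with ℕ.≤-total r m
... | inj₁ r≤m = begin
  + (m ∸ (N ∸ (m + r))) - + (m ∸ (N ∸ r))  ≡⟨ cong₂ (λ x y → + x - + y) upper lower ⟩
  + r - + 0                                ≡⟨ ℤ.+-identityʳ (+ r) ⟩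
  + r                                      ≡⟨ cong +_ (ℕ.m≤n⇒m⊓n≡m (ℕ.m+n≤o⇒m≤o∸n r r+r≤N)) ⟨
  + (r ⊓ (N ∸ r))                          ∎
  where
  open ≡-Reasoning
  r+r≤N : r + r ≤ N
  r+r≤N = ℕ.≤-trans (ℕ.+-mono-≤ r≤m r≤m) (ℕ.≤-reflexive m+m≡N)
  upper : m ∸ (N ∸ (m + r)) ≡ r
  upper = begin
    m ∸ (N ∸ (m + r))        ≡⟨ cong (λ t → m ∸ (t ∸ (m + r))) m+m≡N ⟨
    m ∸ ((m + m) ∸ (m + r))  ≡⟨ cong (m ∸_) (ℕ.[m+n]∸[m+o]≡n∸o m m r) ⟩
    m ∸ (m ∸ r)              ≡⟨ ℕ.m∸[m∸n]≡n r≤m ⟩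
    r                        ∎
  lower : m ∸ (N ∸ r) ≡ 0
  lower = ℕ.m≤n⇒m∸n≡0 (ℕ.m+n≤o⇒m≤o∸n m (ℕ.≤-trans (ℕ.+-monoʳ-≤ m r≤m) (ℕ.≤-reflexive m+m≡N)))
... | inj₂ m≤r = begin
  + (m ∸ (N ∸ (m + r))) - + (m ∸ s)  ≡⟨ cong (λ t → + (m ∸ t) - + (m ∸ s)) (ℕ.m≤n⇒m∸n≡0 N≤m+r) ⟩
  + m - + (m ∸ s)                    ≡⟨ ℤ.m-n≡m⊖n m (m ∸ s) ⟩
  m ℤ.⊖ (m ∸ s)                      ≡⟨ ℤ.⊖-≥ (ℕ.m∸n≤m m s) ⟩
  + (m ∸ (m ∸ s))                    ≡⟨ cong +_ (ℕ.m∸[m∸n]≡n s≤m) ⟩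
  + s                                ≡⟨ cong +_ (ℕ.m≥n⇒m⊓n≡n s≤r) ⟨
  + (r ⊓ s)                          ∎
  where
  open ≡-Reasoning
  s : ℕ
  s = N ∸ r
  N≤m+r : N ≤ m + r
  N≤m+r = ℕ.≤-trans (ℕ.≤-reflexive (sym m+m≡N)) (ℕ.+-monoʳ-≤ m m≤r)
  s≤m : s ≤ m
  s≤m = ℕ.m≤n+o⇒m∸n≤o N r (ℕ.≤-trans N≤m+r (ℕ.≤-reflexive (ℕ.+-comm m r)))
  s≤r : s ≤ r
  s≤r = ℕ.m≤n+o⇒m∸n≤o N r (ℕ.≤-trans (ℕ.≤-reflexive (sym m+m≡N)) (ℕ.+-mono-≤ m≤r m≤r))

module _ (m : ℕ) .{{_ : NonZero m}} where
  private instance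
    2m≢0 : NonZero (2 * m)
    2m≢0 = ℕ.m*n≢0 2 m

  half-sums-difference : ∀ n →
    sumFrom m m (λ i → (n + i) div (2 * m)) - sumFrom 0 m (λ i → (n + i) div (2 * m))
      ≡ + (n ℕ.% (2 * m) ⊓ (2 * m ∸ n ℕ.% (2 * m)))
  half-sums-difference n = begin
    sumFrom m m (λ i → (n + i) div N) - sumFrom 0 m (λ i → (n + i) div N)
      ≡⟨ cong₂ _-_ (half-sum m ℕ.≤-refl) (half-sum 0 ℕ.z≤n) ⟩
    (+ (m ∸ (N ∸ (m + r))) ℤ.+ + (m * q)) - (+ (m ∸ (N ∸ r)) ℤ.+ + (m * q))
      ≡⟨ [i+k]-[j+k]≡i-j (+ (m ∸ (N ∸ (m + r)))) (+ (m ∸ (N ∸ r))) (+ (m * q)) ⟩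
    + (m ∸ (N ∸ (m + r))) - + (m ∸ (N ∸ r))
      ≡⟨ upper-minus-lower-count m r m+m≡2m ⟩
    + (r ⊓ (N ∸ r))
      ∎
    where
    N q r : ℕ
    N = 2 * m
    q = n ℕ./ N
    r = n ℕ.% N
    open ≡-Reasoning
    m+m≡2m : m + m ≡ N
    m+m≡2m = cong (λ t → m + t) (sym (ℕ.+-identityʳ m))
    [i+k]-[j+k]≡i-j : ∀ i j k → (i ℤ.+ k) - (j ℤ.+ k) ≡ i - j
    [i+k]-[j+k]≡i-j = ℤ-Solver.solve-∀
    half-sum : ∀ a → a ≤ m → sumFrom a m (λ i → (n + i) div N) ≡ + (m ∸ (N ∸ (a + r))) ℤ.+ + (m * q)
    half-sum a a≤m = begin
      sumFrom a m (λ i → (n + i) div N)         ≡⟨ sumFrom-shift n a m (_div N) ⟩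
      sumFrom (n + a) m (_div N)                ≡⟨ cong (λ b → sumFrom b m (_div N)) n+a≡a+r+qN ⟩
      sumFrom (a + r + q * N) m (_div N)        ≡⟨ sumFrom-div-periodic N (a + r) m q ⟩
      sumFrom (a + r) m (_div N) ℤ.+ + (m * q)  ≡⟨ cong (ℤ._+ + (m * q)) (sumFrom-div-window N (a + r) m a+r+m≤2N) ⟩
      + (m ∸ (N ∸ (a + r))) ℤ.+ + (m * q)       ∎
      where
      n+a≡a+r+qN : n + a ≡ a + r + q * N
      n+a≡a+r+qN = trans (cong (_+ a) (ℕ.m≡m%n+[m/n]*n n N)) (x+y+z≡z+x+y r (q * N) a)
        where
        x+y+z≡z+x+y : ∀ x y z → x + y + z ≡ z + x + y
        x+y+z≡z+x+y = ℕ-Solver.solve-∀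
      a+r+m≤2N : a + r + m ≤ N + N
      a+r+m≤2N = ℕ.≤-trans (ℕ.≤-reflexive (x+y+z≡y+[x+z] a r m))
        (ℕ.+-mono-≤ (ℕ.<⇒≤ (ℕ.m%n<n n N)) (ℕ.≤-trans (ℕ.+-monoˡ-≤ m a≤m) (ℕ.≤-reflexive m+m≡2m)))
        where
        x+y+z≡y+[x+z] : ∀ x y z → x + y + z ≡ y + (x + z)
        x+y+z≡y+[x+z] = ℕ-Solver.solve-∀

toℚᵘ-/ : ∀ i N .{{_ : NonZero N}} → toℚᵘ (i / N) ≃ mkℚᵘ i (ℕ.pred N)
toℚᵘ-/ i (suc d) = ℚ.toℚᵘ-fromℚᵘ (mkℚᵘ i d)

ℤtoℚ-mono-≤ : ∀ {i j} → i ℤ.≤ j → ℤtoℚ i ℚ.≤ ℤtoℚ j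
ℤtoℚ-mono-≤ {i} {j} i≤j = ℚ.toℚᵘ-cancel-≤
  (ℚᵘ.≤-respˡ-≃ (ℚᵘ.≃-sym (toℚᵘ-/ i 1)) (ℚᵘ.≤-respʳ-≃ (ℚᵘ.≃-sym (toℚᵘ-/ j 1))
    (*≤* (ℤ.*-monoʳ-≤-nonNeg (+ 1) i≤j))))

ℤtoℚ-⊓ : ∀ i j → ℤtoℚ (i ℤ.⊓ j) ≡ ℤtoℚ i ℚ.⊓ ℤtoℚ j
ℤtoℚ-⊓ i j with ℤ.≤-total i j
... | inj₁ i≤j = trans (cong ℤtoℚ (ℤ.i≤j⇒i⊓j≡i i≤j)) (sym (ℚ.p≤q⇒p⊓q≡p (ℤtoℚ-mono-≤ i≤j)))
... | inj₂ j≤i = trans (cong ℤtoℚ (ℤ.i≥j⇒i⊓j≡j j≤i)) (sym (ℚ.p≥q⇒p⊓q≡q (ℤtoℚ-mono-≤ j≤i)))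

toℚᵘ-*[-] : ∀ s p q → toℚᵘ (s *ℚ (p ℚ.- q)) ≃ toℚᵘ s ℚᵘ.* (toℚᵘ p ℚᵘ.- toℚᵘ q)
toℚᵘ-*[-] s p q = ℚᵘ.≃-trans (ℚ.toℚᵘ-homo-* s (p ℚ.- q))
  (ℚᵘ.*-congˡ {toℚᵘ s} (ℚᵘ.≃-trans (ℚ.toℚᵘ-homo-+ p (ℚ.- q)) (ℚᵘ.+-congʳ (toℚᵘ p) (ℚ.toℚᵘ-homo‿- q))))

N*[a/N-b]≡a-b*N : ∀ a b N .{{_ : NonZero N}} → ℤtoℚ (+ N) *ℚ (a / N ℚ.- ℤtoℚ b) ≡ ℤtoℚ (a - b ℤ.* + N)
N*[a/N-b]≡a-b*N a b N@(suc d) = ℚ.toℚᵘ-injective (begin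
  toℚᵘ (ℤtoℚ (+ N) *ℚ (a / N ℚ.- ℤtoℚ b))                    ≈⟨ toℚᵘ-*[-] (ℤtoℚ (+ N)) (a / N) (ℤtoℚ b) ⟩
  toℚᵘ (ℤtoℚ (+ N)) ℚᵘ.* (toℚᵘ (a / N) ℚᵘ.- toℚᵘ (ℤtoℚ b))   ≈⟨ ℚᵘ.*-cong (toℚᵘ-/ (+ N) 1)
                                                                  (ℚᵘ.+-cong (toℚᵘ-/ a N) (ℚᵘ.-‿cong (toℚᵘ-/ b 1))) ⟩
  mkℚᵘ (+ N) 0 ℚᵘ.* (mkℚᵘ a d ℚᵘ.- mkℚᵘ b 0)                 ≈⟨ *≡* (trans (cross-multiplied a b (+ N))
                                                                  (cong ((a - b ℤ.* + N) ℤ.*_) (sym denominator))) ⟩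
  mkℚᵘ (a - b ℤ.* + N) 0                                      ≈⟨ toℚᵘ-/ (a - b ℤ.* + N) 1 ⟨
  toℚᵘ (ℤtoℚ (a - b ℤ.* + N))                                 ∎)
  where
  open ℚᵘ.≃-Reasoning
  denominator : + (1 ℕ.* (N ℕ.* 1)) ≡ + N
  denominator = cong +_ (trans (ℕ.*-identityˡ _) (ℕ.*-identityʳ N))
  cross-multiplied : ∀ a b n → (n ℤ.* (a ℤ.* + 1 ℤ.+ ℤ.- b ℤ.* n)) ℤ.* + 1 ≡ (a - b ℤ.* n) ℤ.* n
  cross-multiplied = ℤ-Solver.solve-∀

N*[b-a/N]≡b*N-a : ∀ a b N .{{_ : NonZero N}} → ℤtoℚ (+ N) *ℚ (ℤtoℚ b ℚ.- a / N) ≡ ℤtoℚ (b ℤ.* + N - a)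
N*[b-a/N]≡b*N-a a b N@(suc d) = ℚ.toℚᵘ-injective (begin
  toℚᵘ (ℤtoℚ (+ N) *ℚ (ℤtoℚ b ℚ.- a / N))                    ≈⟨ toℚᵘ-*[-] (ℤtoℚ (+ N)) (ℤtoℚ b) (a / N) ⟩
  toℚᵘ (ℤtoℚ (+ N)) ℚᵘ.* (toℚᵘ (ℤtoℚ b) ℚᵘ.- toℚᵘ (a / N))   ≈⟨ ℚᵘ.*-cong (toℚᵘ-/ (+ N) 1)
                                                                  (ℚᵘ.+-cong (toℚᵘ-/ b 1) (ℚᵘ.-‿cong (toℚᵘ-/ a N))) ⟩
  mkℚᵘ (+ N) 0 ℚᵘ.* (mkℚᵘ b 0 ℚᵘ.- mkℚᵘ a d)                 ≈⟨ *≡* (trans (cross-multiplied a b (+ N))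
                                                                  (cong ((b ℤ.* + N - a) ℤ.*_) (sym denominator))) ⟩
  mkℚᵘ (b ℤ.* + N - a) 0                                      ≈⟨ toℚᵘ-/ (b ℤ.* + N - a) 1 ⟨
  toℚᵘ (ℤtoℚ (b ℤ.* + N - a))                                 ∎)
  where
  open ℚᵘ.≃-Reasoning
  denominator : + (1 ℕ.* (1 ℕ.* N)) ≡ + N
  denominator = cong +_ (trans (ℕ.*-identityˡ _) (ℕ.*-identityˡ N))
  cross-multiplied : ∀ a b n → (n ℤ.* (b ℤ.* n ℤ.+ ℤ.- a ℤ.* + 1)) ℤ.* + 1 ≡ (b ℤ.* n - a) ℤ.* n
  cross-multiplied = ℤ-Solver.solve-∀

floor-mkℚ+ : ∀ a b .{{_ : NonZero b}} .(c : Coprime a b) → floor (mkℚ+ a b c) ≡ + (a ℕ./ b)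
floor-mkℚ+ a (suc d) c = ℤ.div-pos-is-/ℕ (+ a) (suc d)

-- ceiling p is - floor (- p), and ℤ division of a negative numerator looks at the remainder.
ceiling-mkℚ+-∣ : ∀ a b .{{_ : NonZero b}} .(c : Coprime a b) → a ℕ.% b ≡ 0 →
                 ceiling (mkℚ+ a b c) ≡ + (a ℕ./ b)
ceiling-mkℚ+-∣ zero    (suc d) c _ = refl
ceiling-mkℚ+-∣ (suc a) (suc d) c a%b≡0 rewrite a%b≡0 =
  trans (cong ℤ.-_ (ℤ.*-identityˡ _)) (ℤ.neg-involutive _)

ceiling-mkℚ+-∤ : ∀ a b .{{_ : NonZero b}} .(c : Coprime a b) → ¬ (a ℕ.% b ≡ 0) →
                 ceiling (mkℚ+ a b c) ≡ + suc (a ℕ./ b)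
ceiling-mkℚ+-∤ zero    (suc d) c a%b≢0 with () ← a%b≢0 refl
ceiling-mkℚ+-∤ (suc a) (suc d) c a%b≢0 with suc a ℕ.% suc d
... | zero  with () ← a%b≢0 refl
... | suc _ = cong ℤ.-_ (ℤ.*-identityˡ ℤ.-[1+ suc a ℕ./ suc d ])

-- + k / N unfolds to mkℚ+ (k / g) (N / g) _ with g = gcd k N.
module _ (k N : ℕ) .{{_ : NonZero N}} where
  private
    g : ℕ
    g = ℕ.gcd k N
    instance
      g≢0 : NonZero g
      g≢0 = ℕ.≢-nonZero (ℕ.gcd[m,n]≢0 k N (inj₂ (ℕ.≢-nonZero⁻¹ N)))
      N/g≢0 : NonZero (N ℕ./ g)
      N/g≢0 = ℕ.≢-nonZero (ℕ.n/gcd[m,n]≢0 k N)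
      N/g*g≢0 : NonZero (N ℕ./ g ℕ.* g)
      N/g*g≢0 = ℕ.m*n≢0 (N ℕ./ g) g
    k/g*g≡k : k ℕ./ g ℕ.* g ≡ k
    k/g*g≡k = ℕ.m/n*n≡m (ℕ.gcd[m,n]∣m k N)
    N/g*g≡N : N ℕ./ g ℕ.* g ≡ N
    N/g*g≡N = ℕ.m/n*n≡m (ℕ.gcd[m,n]∣n k N)

    [k/g]/[N/g]≡k/N : (k ℕ./ g) ℕ./ (N ℕ./ g) ≡ k ℕ./ N
    [k/g]/[N/g]≡k/N = trans (sym (ℕ.m*n/o*n≡m/o (k ℕ./ g) g (N ℕ./ g)))
                            (trans (ℕ./-congˡ {o = N ℕ./ g ℕ.* g} k/g*g≡k) (ℕ./-congʳ N/g*g≡N))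

    [k/g]%[N/g]*g≡k%N : (k ℕ./ g) ℕ.% (N ℕ./ g) ℕ.* g ≡ k ℕ.% N
    [k/g]%[N/g]*g≡k%N = trans (ℕ.m%n*o≡m*o%[n*o] (k ℕ./ g) (N ℕ./ g) g)
                              (trans (ℕ.%-congˡ {o = N ℕ./ g ℕ.* g} k/g*g≡k) (ℕ.%-congʳ N/g*g≡N))

  floor-/ : floor (+ k / N) ≡ + (k ℕ./ N)
  floor-/ = trans (floor-mkℚ+ _ _ (coprime-/gcd k N)) (cong +_ [k/g]/[N/g]≡k/N)

  ceiling-/-∣ : k ℕ.% N ≡ 0 → ceiling (+ k / N) ≡ + (k ℕ./ N)
  ceiling-/-∣ k%N≡0 = trans (ceiling-mkℚ+-∣ _ _ (coprime-/gcd k N) reduced≡0) (cong +_ [k/g]/[N/g]≡k/N)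
    where
    reduced≡0 : (k ℕ./ g) ℕ.% (N ℕ./ g) ≡ 0
    reduced≡0 = ℕ.m*n≡0⇒m≡0 _ g (trans [k/g]%[N/g]*g≡k%N k%N≡0)

  ceiling-/-∤ : ¬ (k ℕ.% N ≡ 0) → ceiling (+ k / N) ≡ + suc (k ℕ./ N)
  ceiling-/-∤ k%N≢0 = trans (ceiling-mkℚ+-∤ _ _ (coprime-/gcd k N) reduced≢0) (cong (λ q → + suc q) [k/g]/[N/g]≡k/N)
    where
    reduced≢0 : ¬ ((k ℕ./ g) ℕ.% (N ℕ./ g) ≡ 0)
    reduced≢0 eq = k%N≢0 (trans (sym [k/g]%[N/g]*g≡k%N) (cong (ℕ._* g) eq))

  private
    q r : ℕ
    q = k ℕ./ N
    r = k ℕ.% N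
    k≡r+q*N : + k ≡ + r ℤ.+ + q ℤ.* + N
    k≡r+q*N = ℤ.a≡a%ℕn+[a/ℕn]*n (+ k) N

  N*[k/N-⌊k/N⌋]≡k%N : ℤtoℚ (+ N) *ℚ (+ k / N ℚ.- ℤtoℚ (floor (+ k / N))) ≡ ℤtoℚ (+ (k ℕ.% N))
  N*[k/N-⌊k/N⌋]≡k%N = begin
    ℤtoℚ (+ N) *ℚ (+ k / N ℚ.- ℤtoℚ (floor (+ k / N)))  ≡⟨ cong (λ z → ℤtoℚ (+ N) *ℚ (+ k / N ℚ.- ℤtoℚ z)) floor-/ ⟩
    ℤtoℚ (+ N) *ℚ (+ k / N ℚ.- ℤtoℚ (+ q))              ≡⟨ N*[a/N-b]≡a-b*N (+ k) (+ q) N ⟩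
    ℤtoℚ (+ k - + q ℤ.* + N)                            ≡⟨ cong (λ z → ℤtoℚ (z - + q ℤ.* + N)) k≡r+q*N ⟩
    ℤtoℚ (+ r ℤ.+ + q ℤ.* + N - + q ℤ.* + N)            ≡⟨ cong ℤtoℚ ([i+j]-j≡i (+ r) (+ q ℤ.* + N)) ⟩
    ℤtoℚ (+ r)                                          ∎
    where
    open ≡-Reasoning
    [i+j]-j≡i : ∀ i j → i ℤ.+ j - j ≡ i
    [i+j]-j≡i = ℤ-Solver.solve-∀

  N*[⌈k/N⌉-k/N]≡0 : k ℕ.% N ≡ 0 → ℤtoℚ (+ N) *ℚ (ℤtoℚ (ceiling (+ k / N)) ℚ.- + k / N) ≡ ℤtoℚ (+ 0)
  N*[⌈k/N⌉-k/N]≡0 r≡0 = begin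
    ℤtoℚ (+ N) *ℚ (ℤtoℚ (ceiling (+ k / N)) ℚ.- + k / N)  ≡⟨ cong (λ z → ℤtoℚ (+ N) *ℚ (ℤtoℚ z ℚ.- + k / N)) (ceiling-/-∣ r≡0) ⟩
    ℤtoℚ (+ N) *ℚ (ℤtoℚ (+ q) ℚ.- + k / N)                ≡⟨ N*[b-a/N]≡b*N-a (+ k) (+ q) N ⟩
    ℤtoℚ (+ q ℤ.* + N - + k)                              ≡⟨ cong (λ z → ℤtoℚ (+ q ℤ.* + N - z)) k≡r+q*N ⟩
    ℤtoℚ (+ q ℤ.* + N - (+ r ℤ.+ + q ℤ.* + N))            ≡⟨ cong ℤtoℚ (j-[i+j]≡-i (+ r) (+ q ℤ.* + N)) ⟩
    ℤtoℚ (ℤ.- + r)                                        ≡⟨ cong (λ z → ℤtoℚ (ℤ.- + z)) r≡0 ⟩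
    ℤtoℚ (+ 0)                                            ∎
    where
    open ≡-Reasoning
    j-[i+j]≡-i : ∀ i j → j - (i ℤ.+ j) ≡ ℤ.- i
    j-[i+j]≡-i = ℤ-Solver.solve-∀

  N*[⌈k/N⌉-k/N]≡N∸k%N : ¬ (k ℕ.% N ≡ 0) →
                        ℤtoℚ (+ N) *ℚ (ℤtoℚ (ceiling (+ k / N)) ℚ.- + k / N) ≡ ℤtoℚ (+ (N ∸ k ℕ.% N))
  N*[⌈k/N⌉-k/N]≡N∸k%N r≢0 = begin
    ℤtoℚ (+ N) *ℚ (ℤtoℚ (ceiling (+ k / N)) ℚ.- + k / N)  ≡⟨ cong (λ z → ℤtoℚ (+ N) *ℚ (ℤtoℚ z ℚ.- + k / N)) (ceiling-/-∤ r≢0) ⟩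
    ℤtoℚ (+ N) *ℚ (ℤtoℚ (+ suc q) ℚ.- + k / N)            ≡⟨ N*[b-a/N]≡b*N-a (+ k) (+ suc q) N ⟩
    ℤtoℚ (+ suc q ℤ.* + N - + k)                          ≡⟨ cong (λ z → ℤtoℚ (+ suc q ℤ.* + N - z)) k≡r+q*N ⟩
    ℤtoℚ ((+ 1 ℤ.+ + q) ℤ.* + N - (+ r ℤ.+ + q ℤ.* + N))  ≡⟨ cong ℤtoℚ ([1+j]*n-[i+j*n]≡n-i (+ r) (+ q) (+ N)) ⟩
    ℤtoℚ (+ N - + r)                                      ≡⟨ cong ℤtoℚ (ℤ.m-n≡m⊖n N r) ⟩
    ℤtoℚ (N ℤ.⊖ r)                                        ≡⟨ cong ℤtoℚ (ℤ.⊖-≥ (ℕ.<⇒≤ (ℕ.m%n<n k N))) ⟩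
    ℤtoℚ (+ (N ∸ r))                                      ∎
    where
    open ≡-Reasoning
    [1+j]*n-[i+j*n]≡n-i : ∀ i j n → (+ 1 ℤ.+ j) ℤ.* n - (i ℤ.+ j ℤ.* n) ≡ n - i
    [1+j]*n-[i+j*n]≡n-i = ℤ-Solver.solve-∀

N*Zigzag[k/N]≡r⊓[N∸r] : ∀ k N .{{_ : NonZero N}} →
                        ℤtoℚ (+ N) *ℚ Zigzag (+ k / N) ≡ ℤtoℚ (+ (k ℕ.% N ⊓ (N ∸ k ℕ.% N)))
N*Zigzag[k/N]≡r⊓[N∸r] k N = trans (ℚ.mono-≤-distrib-⊓ (ℚ.*-monoˡ-≤-nonNeg (ℤtoℚ (+ N))) _ _)
                                  (by-cases (r ℕ.≟ 0))
  where
  x : ℚ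
  x = + k / N
  r : ℕ
  r = k ℕ.% N
  instance
    N≥0 : ℚ.NonNegative (ℤtoℚ (+ N))
    N≥0 = ℚ.normalize-nonNeg N 1
  N*frac N*cofrac : ℚ
  N*frac = ℤtoℚ (+ N) *ℚ (x ℚ.- ℤtoℚ (floor x))
  N*cofrac = ℤtoℚ (+ N) *ℚ (ℤtoℚ (ceiling x) ℚ.- x)
  by-cases : Dec (r ≡ 0) → N*frac ℚ.⊓ N*cofrac ≡ ℤtoℚ (+ (r ⊓ (N ∸ r)))
  by-cases (yes r≡0) = begin
    N*frac ℚ.⊓ N*cofrac         ≡⟨ cong₂ ℚ._⊓_ {x = N*frac} {u = N*cofrac} (N*[k/N-⌊k/N⌋]≡k%N k N) (N*[⌈k/N⌉-k/N]≡0 k N r≡0) ⟩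
    ℤtoℚ (+ r) ℚ.⊓ ℤtoℚ (+ 0)   ≡⟨ ℤtoℚ-⊓ (+ r) (+ 0) ⟨
    ℤtoℚ (+ (r ⊓ 0))            ≡⟨ cong (λ z → ℤtoℚ (+ (z ⊓ 0))) r≡0 ⟩
    ℤtoℚ (+ 0)                  ≡⟨ cong (λ z → ℤtoℚ (+ (z ⊓ (N ∸ z)))) r≡0 ⟨
    ℤtoℚ (+ (r ⊓ (N ∸ r)))      ∎
    where open ≡-Reasoning
  by-cases (no r≢0) = begin
    N*frac ℚ.⊓ N*cofrac               ≡⟨ cong₂ ℚ._⊓_ {x = N*frac} {u = N*cofrac} (N*[k/N-⌊k/N⌋]≡k%N k N) (N*[⌈k/N⌉-k/N]≡N∸k%N k N r≢0) ⟩
    ℤtoℚ (+ r) ℚ.⊓ ℤtoℚ (+ (N ∸ r))   ≡⟨ ℤtoℚ-⊓ (+ r) (+ (N ∸ r)) ⟨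
    ℤtoℚ (+ (r ⊓ (N ∸ r)))            ∎
    where open ≡-Reasoning

theorem2p2 : (n m : ℕ) → .{{_ : NonZero m}} →
    ℤtoℚ (sumFrom m m (λ i → floor (_/_ (+ (n + i)) (2 * m) {{m*n≢0 2 m}}))
          - sumFrom 0 m (λ i → floor (_/_ (+ (n + i)) (2 * m) {{m*n≢0 2 m}})))
      ≡ ℤtoℚ (+ (2 * m)) *ℚ Zigzag (_/_ (+ n) (2 * m) {{m*n≢0 2 m}})
theorem2p2 n m = begin
  ℤtoℚ (sumFrom m m (λ i → floor (+ (n + i) / N)) - sumFrom 0 m (λ i → floor (+ (n + i) / N)))
    ≡⟨ cong ℤtoℚ (cong₂ _-_ (sumFrom-cong m m floor≗div) (sumFrom-cong 0 m floor≗div)) ⟩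
  ℤtoℚ (sumFrom m m (λ i → (n + i) div N) - sumFrom 0 m (λ i → (n + i) div N))
    ≡⟨ cong ℤtoℚ (half-sums-difference m n) ⟩
  ℤtoℚ (+ (n ℕ.% N ⊓ (N ∸ n ℕ.% N)))
    ≡⟨ N*Zigzag[k/N]≡r⊓[N∸r] n N ⟨
  ℤtoℚ (+ N) *ℚ Zigzag (+ n / N)
    ∎
  where
  open ≡-Reasoning
  N : ℕ
  N = 2 * m
  instance
    N≢0 : NonZero N
    N≢0 = m*n≢0 2 m
  floor≗div : ∀ i → floor (+ (n + i) / N) ≡ (n + i) div N
  floor≗div i = floor-/ (n + i) N
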